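{- Let $(x_1,\varrho_1)$ and $(x_2,\varrho_2)$ be two divisor-and-rotor configurations on a strongly connected ribbon digraph $G$. If $(x_2,\varrho_2)$ is recurrent, then $(x_2,\varrho_2)$ can be reached from $(x_1,\varrho_1)$ by a legal game if and only if $(x_1,\varrho_1)\sim(x_2,\varrho_2)$.
   Context: A digraph here is strongly connected, may have multiple edges, and has no loops. A ribbon digraph is a digraph with, for each vertex $v$, a fixed cyclic ordering of the edges leaving $v$; $e^+$ denotes the edge after $e$. A divisor is $x\in\mathbb{Z}^{V(G)}$. A rotor configuration $\varrho$ assigns to each vertex $v$ an edge $\varrho(v)$ with tail $v$. A divisor-and-rotor configuration (DRC) is a pair $(x,\varrho)$. Routing at $v$ transforms $(x,\varrho)$ into $(x',\varrho')$ with $\varrho'(v)=\varrho(v)^+$, $\varrho'(u)=\varrho(u)$ for $u\ne v$, and $x'=x-\mathbf{1}_v+\mathbf{1}_{v'}$ where $v'$ is the head of $\varrho(v)^+$. The routing is legal if $x(v)>0$; without this condition it is called unconstrained. A legal game is a sequence of configurations each obtained from the previous by a legal routing. A DRC is recurrent if some legal game with at least one routing leads from it back to itself. Two DRCs are linearly equivalent, $(x_1,\varrho_1)\sim(x_2,\varrho_2)$, if $(x_2,\varrho_2)$ can be reached from $(x_1,\varrho_1)$ by a sequence of unconstrained routings. -}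

module Defs where

open import Data.Nat as ℕ using (ℕ; zero; suc)
open import Data.Fin as Fin using (Fin; zero; suc; toℕ; lower₁)
open import Data.Integer as ℤ using (ℤ; _+_; _-_; 0ℤ; 1ℤ; _>_)
open import Data.Product using (Σ; ∃; _×_; _,_; proj₁; proj₂)
open import Relation.Nullary using (¬_; yes; no)
open import Relation.Binary.PropositionalEquality using (_≡_; _≢_)
open import Relation.Binary.Construct.Closure.ReflexiveTransitive using (Star)
open import Relation.Binary.Construct.Closure.Transitive using (TransClosure)

nextFin : ∀ {m} → Fin m → Fin m
nextFin {suc m} i with m ℕ.≟ toℕ i
... | yes _ = zero
... | no p  = suc (lower₁ i p)

-- Vertices are Fin n; the edges leaving v are Fin (deg v), with the cyclic
-- order 0 < 1 < ... < deg v - 1 < 0, and head v e is the head of edge e.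
record RibbonDigraph : Set where
  field
    n       : ℕ
    deg     : Fin n → ℕ
    head    : (v : Fin n) → Fin (deg v) → Fin n
    noLoops : ∀ v e → head v e ≢ v
  Edge : Fin n → Fin n → Set
  Edge u w = ∃ λ (e : Fin (deg u)) → head u e ≡ w
  field
    strong  : ∀ u w → Star Edge u w

module _ (G : RibbonDigraph) where
  open RibbonDigraph G

  Divisor : Set
  Divisor = Fin n → ℤ

  RotorConfig : Set
  RotorConfig = (v : Fin n) → Fin (deg v)

  DRC : Set
  DRC = Divisor × RotorConfig

  𝟙 : Fin n → Divisor
  𝟙 v u with u Fin.≟ v
  ... | yes _ = 1ℤ
  ... | no _  = 0ℤ

  _⁺ : ∀ {v} → Fin (deg v) → Fin (deg v)
  e ⁺ = nextFin e

  route : Fin n → DRC → DRC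
  route v (x , ρ) = x′ , ρ′
    where
      ρ′ : RotorConfig
      ρ′ u with u Fin.≟ v
      ... | yes _ = (ρ u) ⁺
      ... | no _  = ρ u
      x′ : Divisor
      x′ u = x u - 𝟙 v u + 𝟙 (head v ((ρ v) ⁺)) u

  _≈_ : DRC → DRC → Set
  (x , ρ) ≈ (y , σ) = (∀ u → x u ≡ y u) × (∀ u → ρ u ≡ σ u)

  UStep : DRC → DRC → Set
  UStep c c′ = ∃ λ v → route v c ≈ c′

  LegalStep : DRC → DRC → Set
  LegalStep c c′ = ∃ λ v → (proj₁ c v > 0ℤ) × (route v c ≈ c′)

  LegalGame : DRC → DRC → Set
  LegalGame = Star LegalStep

  Recurrent : DRC → Set
  Recurrent c = TransClosure LegalStep c c

  _∼_ : DRC → DRC → Set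
  _∼_ = Star UStep

module Submission where

-- A legal game is in particular a sequence of unconstrained routings, which gives (⇒).  For (⇐)
-- write the unconstrained routings from c₁ to c₂ as a word R of vertices.  Routings commute, so the
-- letters of R may be performed in any order; we route greedily, always a letter that currently
-- holds a chip (greedy).  If R runs out we have reached c₂; otherwise we get stuck with every
-- remaining letter holding no chip, which contradicts recurrence (stuck).  The contradiction rests on
-- three facts about a legal cycle at c₂: it routes every vertex (cycle-routes-all: rotors make full
-- turns, chips are counted, and G is strongly connected), so c₂ has no negative vertex
-- (cycle-nonneg); the chips on a vertex set S do not increase under routings inside S and drop when a
-- chip leaves S (chipsOn-run-inside/-leaves), so the stuck letters S keep their chips, end empty
-- and with rotors pointing into S; but the last routing in S during the cycle sends its chip either
-- out of S along the final rotor or to a vertex of S that keeps it (last-routed).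

open import Defs
open import Function.Bundles using (_⇔_; mk⇔)
open import Function.Base using (_∘_)
open import Data.Nat as ℕ using (ℕ; zero; suc; _∸_; z≤n; s≤s; s≤s⁻¹)
import Data.Nat.Properties as ℕP
open import Data.Fin as Fin using (Fin; zero; suc; toℕ)
import Data.Fin.Properties as FinP
open import Data.Product using (∃; _×_; _,_; proj₁; proj₂)
open import Data.Sum using (_⊎_; inj₁; inj₂)
open import Data.Empty using (⊥; ⊥-elim)
open import Data.Unit using (⊤; tt)
open import Data.Bool using (Bool; true; false; _≟_)
import Data.Bool.Properties as BoolP
open import Data.Integer as ℤ using (ℤ; _+_; _-_; 0ℤ; 1ℤ; _≤_; _<_)
import Data.Integer.Properties as ℤP
open import Data.Integer.Tactic.RingSolver using (solve-∀)
open import Data.List using (List; []; _∷_; _++_; length)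
open import Data.List.Membership.Propositional using (_∈_; _∉_; lose; find)
open import Data.List.Membership.Propositional.Properties using (∈-++⁻)
open import Data.List.Relation.Unary.Any using (Any; here; there; any?)
open import Relation.Nullary using (Dec; yes; no)
open import Relation.Nullary.Decidable using (does; dec-true)
open import Relation.Binary.PropositionalEquality
import Relation.Binary.Construct.Closure.ReflexiveTransitive as Star
open Star using (Star; ε; _◅_)
import Relation.Binary.Construct.Closure.Transitive as Plus

iterate : ∀ {m} → ℕ → Fin m → Fin m
iterate zero    a = a
iterate (suc k) a = iterate k (nextFin a)

iterate-suc : ∀ {m} k (a : Fin m) → iterate (suc k) a ≡ nextFin (iterate k a)
iterate-suc zero    a = refl
iterate-suc (suc k) a = iterate-suc k (nextFin a)

iterate-+ : ∀ {m} d k (a : Fin m) → iterate (d ℕ.+ k) a ≡ iterate k (iterate d a)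
iterate-+ zero    k a = refl
iterate-+ (suc d) k a = iterate-+ d k (nextFin a)

nextFin-last : ∀ {m} (i : Fin (suc m)) → m ≡ toℕ i → nextFin i ≡ zero
nextFin-last {m} i e with m ℕ.≟ toℕ i
... | yes _ = refl
... | no ne = ⊥-elim (ne e)

toℕ-nextFin : ∀ {m} (i : Fin (suc m)) → m ≢ toℕ i → toℕ (nextFin i) ≡ suc (toℕ i)
toℕ-nextFin {m} i ne with m ℕ.≟ toℕ i
... | yes e = ⊥-elim (ne e)
... | no p  = cong suc (FinP.toℕ-lower₁ i p)

iterate-to-zero : ∀ {m} d (a : Fin (suc m)) → d ℕ.+ toℕ a ≡ m → iterate (suc d) a ≡ zero
iterate-to-zero zero    a e = nextFin-last a (sym e)
iterate-to-zero {m} (suc d) a e =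
  iterate-to-zero d (nextFin a)
    (trans (cong (d ℕ.+_) (toℕ-nextFin a a≢last)) (trans (ℕP.+-suc d (toℕ a)) e))
  where
    a≢last : m ≢ toℕ a
    a≢last m≡a = ℕP.m≢1+n+m (toℕ a) (sym (trans e m≡a))

toℕ-iterate-zero : ∀ {m} j → j ℕ.≤ m → toℕ (iterate j (zero {n = m})) ≡ j
toℕ-iterate-zero zero    _  = refl
toℕ-iterate-zero {m} (suc j) j<m =
  trans (cong toℕ (iterate-suc j zero)) (trans (toℕ-nextFin (iterate j zero) j≢m) (cong suc IH))
  where
    IH : toℕ (iterate j (zero {n = m})) ≡ j
    IH = toℕ-iterate-zero j (ℕP.<⇒≤ j<m)
    j≢m : m ≢ toℕ (iterate j (zero {n = m}))
    j≢m m≡j = ℕP.<⇒≢ j<m (sym (trans m≡j IH))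

orbit : ∀ {m} (a b : Fin m) → ∃ λ d → iterate d a ≡ b
orbit {suc m} a b = suc (m ∸ toℕ a) ℕ.+ toℕ b ,
  (begin
    iterate (suc (m ∸ toℕ a) ℕ.+ toℕ b) a
      ≡⟨ iterate-+ (suc (m ∸ toℕ a)) (toℕ b) a ⟩
    iterate (toℕ b) (iterate (suc (m ∸ toℕ a)) a)
      ≡⟨ cong (iterate (toℕ b)) (iterate-to-zero (m ∸ toℕ a) a (ℕP.m∸n+n≡m (s≤s⁻¹ (FinP.toℕ<n a)))) ⟩
    iterate (toℕ b) zero
      ≡⟨ FinP.toℕ-injective (toℕ-iterate-zero (toℕ b) (s≤s⁻¹ (FinP.toℕ<n b))) ⟩
    b
      ∎)
  where open ≡-Reasoning

periodic-orbit : ∀ {m} (a : Fin m) k → iterate (suc k) a ≡ a →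
                 ∀ b → ∃ λ j → j ℕ.≤ k × iterate (suc j) a ≡ b
periodic-orbit a k period b with orbit (nextFin a) b
... | d , reach = subst Early reach (early d)
  where
    Early : Fin _ → Set
    Early y = ∃ λ j → j ℕ.≤ k × iterate (suc j) a ≡ y
    early-next : ∀ y → Early y → Early (nextFin y)
    early-next y (j , j≤k , e) with ℕP.m≤n⇒m<n∨m≡n j≤k
    ... | inj₁ j<k  = suc j , j<k , trans (iterate-suc (suc j) a) (cong nextFin e)
    ... | inj₂ refl = 0 , z≤n , sym (cong nextFin (trans (sym e) period))
    early : ∀ d → Early (iterate d (nextFin a))
    early zero    = 0 , z≤n , refl
    early (suc d) = subst Early (sym (iterate-suc d (nextFin a))) (early-next _ (early d))

sumᶠ : ∀ {m} → (Fin m → ℤ) → ℤ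
sumᶠ {zero}  f = 0ℤ
sumᶠ {suc m} f = f zero + sumᶠ (λ i → f (suc i))

sum-cong : ∀ {m} {f g : Fin m → ℤ} → (∀ i → f i ≡ g i) → sumᶠ f ≡ sumᶠ g
sum-cong {zero}  e = refl
sum-cong {suc m} e = cong₂ _+_ (e zero) (sum-cong (λ i → e (suc i)))

sum-linear : ∀ {m} (f g h : Fin m → ℤ) → sumᶠ (λ i → f i - g i + h i) ≡ sumᶠ f - sumᶠ g + sumᶠ h
sum-linear {zero}  f g h = refl
sum-linear {suc m} f g h =
  trans (cong (f zero - g zero + h zero +_) (sum-linear (f ∘ suc) (g ∘ suc) (h ∘ suc)))
        (regroup (f zero) (g zero) (h zero) (sumᶠ (f ∘ suc)) (sumᶠ (g ∘ suc)) (sumᶠ (h ∘ suc)))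
  where
    regroup : ∀ (a b c x y z : ℤ) → a - b + c + (x - y + z) ≡ a + x - (b + y) + (c + z)
    regroup = solve-∀

sum-zero : ∀ {m} (f : Fin m → ℤ) → (∀ i → f i ≡ 0ℤ) → sumᶠ f ≡ 0ℤ
sum-zero {zero}  f z = refl
sum-zero {suc m} f z = cong₂ _+_ (z zero) (sum-zero (f ∘ suc) (z ∘ suc))

sum-single : ∀ {m} (f : Fin m → ℤ) v → (∀ u → u ≢ v → f u ≡ 0ℤ) → sumᶠ f ≡ f v
sum-single {suc m} f zero z =
  trans (cong (f zero +_) (sum-zero (f ∘ suc) (λ i → z (suc i) λ ()))) (ℤP.+-identityʳ (f zero))
sum-single {suc m} f (suc v) z =
  trans (cong₂ _+_ (z zero λ ()) (sum-single (f ∘ suc) v (λ u u≢v → z (suc u) (u≢v ∘ FinP.suc-injective))))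
        (ℤP.+-identityˡ (f (suc v)))

sum-nonneg : ∀ {m} (f : Fin m → ℤ) → (∀ i → 0ℤ ≤ f i) → 0ℤ ≤ sumᶠ f
sum-nonneg {zero}  f h = ℤP.≤-refl
sum-nonneg {suc m} f h = ℤP.+-mono-≤ (h zero) (sum-nonneg (f ∘ suc) (h ∘ suc))

sum-nonpos : ∀ {m} (f : Fin m → ℤ) → (∀ i → f i ≤ 0ℤ) → sumᶠ f ≤ 0ℤ
sum-nonpos {zero}  f h = ℤP.≤-refl
sum-nonpos {suc m} f h = ℤP.+-mono-≤ (h zero) (sum-nonpos (f ∘ suc) (h ∘ suc))

term≤sum : ∀ {m} (f : Fin m → ℤ) → (∀ i → 0ℤ ≤ f i) → ∀ v → f v ≤ sumᶠ f
term≤sum {suc m} f h zero =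
  subst (_≤ sumᶠ f) (ℤP.+-identityʳ (f zero)) (ℤP.+-monoʳ-≤ (f zero) (sum-nonneg (f ∘ suc) (h ∘ suc)))
term≤sum {suc m} f h (suc v) =
  subst (_≤ sumᶠ f) (ℤP.+-identityˡ (f (suc v))) (ℤP.+-mono-≤ (h zero) (term≤sum (f ∘ suc) (h ∘ suc) v))

mask : Bool → ℤ → ℤ
mask true  z = z
mask false z = 0ℤ

mask-zero : ∀ b → mask b 0ℤ ≡ 0ℤ
mask-zero true  = refl
mask-zero false = refl

mask-linear : ∀ b x y z → mask b (x - y + z) ≡ mask b x - mask b y + mask b z
mask-linear true  x y z = refl
mask-linear false x y z = refl

true≢false : true ≢ false
true≢false ()

<-by-one : ∀ {i j} → ℤ.suc i ≡ j → i < j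
<-by-one e = ℤP.suc[i]≤j⇒i<j (ℤP.≤-reflexive e)

module Routing (G : RibbonDigraph) where
  open RibbonDigraph G
  open import Data.List.Membership.DecPropositional (Fin._≟_ {n}) using (_∈?_)

  Vertex : Set
  Vertex = Fin n

  Config : Set
  Config = DRC G

  chips : Config → Vertex → ℤ
  chips = proj₁

  rotor : Config → RotorConfig G
  rotor = proj₂

  routeAt : Vertex → Config → Config
  routeAt = route G

  _≋_ : Config → Config → Set
  _≋_ = _≈_ G

  target : Config → Vertex → Vertex
  target c v = head v (nextFin (rotor c v))

  target≢ : ∀ c v → target c v ≢ v
  target≢ c v = noLoops v (nextFin (rotor c v))

  ≋-refl : ∀ {c} → c ≋ c
  ≋-refl = (λ _ → refl) , (λ _ → refl)

  ≋-sym : ∀ {c d} → c ≋ d → d ≋ c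
  ≋-sym (x≡ , ρ≡) = sym ∘ x≡ , sym ∘ ρ≡

  ≋-trans : ∀ {c d e} → c ≋ d → d ≋ e → c ≋ e
  ≋-trans (x≡ , ρ≡) (y≡ , σ≡) = (λ u → trans (x≡ u) (y≡ u)) , (λ u → trans (ρ≡ u) (σ≡ u))

  𝟙-same : ∀ v → 𝟙 G v v ≡ 1ℤ
  𝟙-same v with v Fin.≟ v
  ... | yes _ = refl
  ... | no v≢v = ⊥-elim (v≢v refl)

  𝟙-other : ∀ {u v} → u ≢ v → 𝟙 G v u ≡ 0ℤ
  𝟙-other {u} {v} u≢v with u Fin.≟ v
  ... | yes u≡v = ⊥-elim (u≢v u≡v)
  ... | no _    = refl

  𝟙-nonneg : ∀ v u → 0ℤ ≤ 𝟙 G v u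
  𝟙-nonneg v u with u Fin.≟ v
  ... | yes _ = ℤ.+≤+ z≤n
  ... | no _  = ℤP.≤-refl

  rotor-routed : ∀ c v → rotor (routeAt v c) v ≡ nextFin (rotor c v)
  rotor-routed c v with v Fin.≟ v
  ... | yes _   = refl
  ... | no v≢v = ⊥-elim (v≢v refl)

  rotor-unrouted : ∀ c {u v} → u ≢ v → rotor (routeAt v c) u ≡ rotor c u
  rotor-unrouted c {u} {v} u≢v with u Fin.≟ v
  ... | yes u≡v = ⊥-elim (u≢v u≡v)
  ... | no _    = refl

  target-unrouted : ∀ c {u v} → u ≢ v → target (routeAt v c) u ≡ target c u
  target-unrouted c {u} u≢v = cong (head u ∘ nextFin) (rotor-unrouted c u≢v)

  chips-at-routed : ∀ c u → chips (routeAt u c) u ≡ ℤ.pred (chips c u)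
  chips-at-routed c u =
    trans (cong₂ (λ a b → chips c u - a + b) (𝟙-same u) (𝟙-other (λ u≡t → target≢ c u (sym u≡t))))
          (minus-one (chips c u))
    where
      minus-one : ∀ x → x - 1ℤ + 0ℤ ≡ ℤ.- 1ℤ + x
      minus-one = solve-∀

  chips-elsewhere : ∀ c {u w} → w ≢ u → chips (routeAt u c) w ≡ 𝟙 G (target c u) w + chips c w
  chips-elsewhere c {u} {w} w≢u =
    trans (cong (λ a → chips c w - a + 𝟙 G (target c u) w) (𝟙-other w≢u)) (reorder (chips c w) _)
    where
      reorder : ∀ x i → x - 0ℤ + i ≡ i + x
      reorder = solve-∀

  chips-routed-nonneg : ∀ {c u} → 0ℤ < chips c u → 0ℤ ≤ chips (routeAt u c) u
  chips-routed-nonneg {c} {u} pos = subst (0ℤ ≤_) (sym (chips-at-routed c u)) (ℤP.i<j⇒i≤pred[j] pos)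

  chips-gain : ∀ c {u w} → w ≢ u → chips c w ≤ chips (routeAt u c) w
  chips-gain c {u} {w} w≢u =
    subst₂ _≤_ (ℤP.+-identityˡ (chips c w)) (sym (chips-elsewhere c w≢u))
           (ℤP.+-monoˡ-≤ (chips c w) (𝟙-nonneg (target c u) w))

  chips-target : ∀ c u → chips (routeAt u c) (target c u) ≡ ℤ.suc (chips c (target c u))
  chips-target c u =
    trans (chips-elsewhere c (target≢ c u)) (cong (_+ chips c (target c u)) (𝟙-same (target c u)))

  routeAt-cong : ∀ v {c d} → c ≋ d → routeAt v c ≋ routeAt v d
  routeAt-cong v {c} {d} (x≡ , ρ≡) = chips≡ , rotor≡
    where
      chips≡ : ∀ u → chips (routeAt v c) u ≡ chips (routeAt v d) u
      chips≡ u rewrite x≡ u | ρ≡ v = refl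
      -- case split on a separately computed decision, so that the goal is not abstracted
      rotor≡′ : ∀ u → Dec (u ≡ v) → rotor (routeAt v c) u ≡ rotor (routeAt v d) u
      rotor≡′ u (yes refl) = trans (rotor-routed c u) (trans (cong nextFin (ρ≡ u)) (sym (rotor-routed d u)))
      rotor≡′ u (no u≢v)   = trans (rotor-unrouted c u≢v) (trans (ρ≡ u) (sym (rotor-unrouted d u≢v)))
      rotor≡ : ∀ u → rotor (routeAt v c) u ≡ rotor (routeAt v d) u
      rotor≡ u = rotor≡′ u (u Fin.≟ v)

  chips-commute : ∀ c {a b} → a ≢ b → ∀ u →
                  chips (routeAt a (routeAt b c)) u ≡ chips (routeAt b (routeAt a c)) u
  chips-commute c {a} {b} a≢b u = begin
    x - δ b + δ tb - δ a + δ (target (routeAt b c) a)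
      ≡⟨ cong (λ t → x - δ b + δ tb - δ a + δ t) (target-unrouted c a≢b) ⟩
    x - δ b + δ tb - δ a + δ ta
      ≡⟨ swap x (δ b) (δ tb) (δ a) (δ ta) ⟩
    x - δ a + δ ta - δ b + δ tb
      ≡⟨ cong (λ t → x - δ a + δ ta - δ b + δ t) (sym (target-unrouted c (a≢b ∘ sym))) ⟩
    x - δ a + δ ta - δ b + δ (target (routeAt a c) b)
      ∎
    where
      open ≡-Reasoning
      x : ℤ
      x = chips c u
      δ : Vertex → ℤ
      δ w = 𝟙 G w u
      ta tb : Vertex
      ta = target c a
      tb = target c b
      swap : ∀ (x p q r s : ℤ) → x - p + q - r + s ≡ x - r + s - p + q
      swap = solve-∀

  rotors-commute : ∀ c {a b} → a ≢ b → ∀ u →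
                   rotor (routeAt a (routeAt b c)) u ≡ rotor (routeAt b (routeAt a c)) u
  rotors-commute c {a} {b} a≢b u = cases (u Fin.≟ a) (u Fin.≟ b)
    where
      b≢a : b ≢ a
      b≢a = a≢b ∘ sym
      cases : Dec (u ≡ a) → Dec (u ≡ b) →
              rotor (routeAt a (routeAt b c)) u ≡ rotor (routeAt b (routeAt a c)) u
      cases (yes refl) _ =
        trans (rotor-routed (routeAt b c) u) (trans (cong nextFin (rotor-unrouted c a≢b))
          (trans (sym (rotor-routed c u)) (sym (rotor-unrouted (routeAt a c) a≢b))))
      cases (no u≢a) (yes refl) =
        trans (rotor-unrouted (routeAt b c) b≢a) (trans (rotor-routed c u)
          (trans (cong nextFin (sym (rotor-unrouted c b≢a))) (sym (rotor-routed (routeAt a c) u))))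
      cases (no u≢a) (no u≢b) =
        trans (rotor-unrouted (routeAt b c) u≢a) (trans (rotor-unrouted c u≢b)
          (trans (sym (rotor-unrouted c u≢a)) (sym (rotor-unrouted (routeAt a c) u≢b))))

  routeAt-comm : ∀ a b c → routeAt a (routeAt b c) ≋ routeAt b (routeAt a c)
  routeAt-comm a b c = commute (a Fin.≟ b)
    where
      commute : Dec (a ≡ b) → routeAt a (routeAt b c) ≋ routeAt b (routeAt a c)
      commute (yes refl) = ≋-refl
      commute (no a≢b)   = chips-commute c a≢b , rotors-commute c a≢b

  run : List Vertex → Config → Config
  run []      c = c
  run (v ∷ p) c = run p (routeAt v c)

  run-cong : ∀ p {c d} → c ≋ d → run p c ≋ run p d
  run-cong []      c≋d = c≋d
  run-cong (v ∷ p) c≋d = run-cong p (routeAt-cong v c≋d)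

  run-++ : ∀ p q c → run (p ++ q) c ≡ run q (run p c)
  run-++ []      q c = refl
  run-++ (v ∷ p) q c = run-++ p q (routeAt v c)

  Legal : List Vertex → Config → Set
  Legal []      c = ⊤
  Legal (v ∷ p) c = 0ℤ < chips c v × Legal p (routeAt v c)

  Legal-cong : ∀ p {c d} → c ≋ d → Legal p c → Legal p d
  Legal-cong []      c≋d legal        = tt
  Legal-cong (v ∷ p) c≋d (pos , legal) =
    subst (0ℤ <_) (proj₁ c≋d v) pos , Legal-cong p (routeAt-cong v c≋d) legal

  Legal-prefix : ∀ p q c → Legal (p ++ q) c → Legal p c
  Legal-prefix []      q c legal         = tt
  Legal-prefix (v ∷ p) q c (pos , legal) = pos , Legal-prefix p q (routeAt v c) legal

  remove : ∀ {v : Vertex} {p} → v ∈ p → List Vertex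
  remove {p = _ ∷ p} (here _)  = p
  remove {p = u ∷ p} (there m) = u ∷ remove m

  length-remove : ∀ {v : Vertex} {p} (m : v ∈ p) → suc (length (remove m)) ≡ length p
  length-remove (here _)  = refl
  length-remove (there m) = cong suc (length-remove m)

  run-to-front : ∀ {v p} c (m : v ∈ p) → run p c ≋ run (v ∷ remove m) c
  run-to-front c (here refl) = ≋-refl
  run-to-front {v} {u ∷ p} c (there m) =
    ≋-trans (run-to-front (routeAt u c) m) (run-cong (remove m) (routeAt-comm v u c))

  unconstrained-word : ∀ {c d} → _∼_ G c d → ∃ λ p → run p c ≋ d
  unconstrained-word ε = [] , ≋-refl
  unconstrained-word ((v , step) ◅ rest) with unconstrained-word rest
  ... | p , reaches = v ∷ p , ≋-trans (run-cong p step) reaches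

  LegalCycle : Config → Set
  LegalCycle c = ∃ λ v → ∃ λ p → Legal (v ∷ p) c × run (v ∷ p) c ≋ c

  legal-word : ∀ {c d} → Plus.TransClosure (LegalStep G) c d →
               ∃ λ v → ∃ λ p → Legal (v ∷ p) c × run (v ∷ p) c ≋ d
  legal-word Plus.[ v , pos , step ] = v , [] , (pos , tt) , step
  legal-word ((v , pos , step) Plus.∷ rest) with legal-word rest
  ... | u , p , legal , reaches =
    v , u ∷ p , (pos , Legal-cong (u ∷ p) (≋-sym step) legal) , ≋-trans (run-cong (u ∷ p) step) reaches

  legal-game : ∀ v p {c d} → Legal (v ∷ p) c → run (v ∷ p) c ≋ d → LegalGame G c d
  legal-game v []      (pos , _)     reaches = (v , pos , reaches) ◅ ε
  legal-game v (u ∷ p) (pos , legal) reaches = (v , pos , ≋-refl) ◅ legal-game u p legal reaches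

  Sends : List Vertex → Config → Vertex → Set
  Sends []      c h = ⊥
  Sends (v ∷ p) c h = target c v ≡ h ⊎ Sends p (routeAt v c) h

  unfired-gain : ∀ p c {w} → w ∉ p → chips c w ≤ chips (run p c) w
  unfired-gain []      c w∉p = ℤP.≤-refl
  unfired-gain (u ∷ p) c w∉p =
    ℤP.≤-trans (chips-gain c (w∉p ∘ here)) (unfired-gain p (routeAt u c) (w∉p ∘ there))

  unfired-strict : ∀ p c {w} → w ∉ p → Sends p c w → chips c w < chips (run p c) w
  unfired-strict (u ∷ p) c w∉p (inj₁ refl) =
    ℤP.<-≤-trans (<-by-one (sym (chips-target c u))) (unfired-gain p (routeAt u c) (w∉p ∘ there))
  unfired-strict (u ∷ p) c w∉p (inj₂ sends) =
    ℤP.≤-<-trans (chips-gain c (w∉p ∘ here)) (unfired-strict p (routeAt u c) (w∉p ∘ there) sends)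

  fired-nonneg : ∀ p c {w} → Legal p c → w ∈ p → 0ℤ ≤ chips (run p c) w
  fired-nonneg (u ∷ p) c (pos , legal) (there w∈p) = fired-nonneg p (routeAt u c) legal w∈p
  fired-nonneg (u ∷ p) c (pos , legal) (here refl) with u ∈? p
  ... | yes u∈p = fired-nonneg p (routeAt u c) legal u∈p
  ... | no u∉p  = ℤP.≤-trans (chips-routed-nonneg {c} pos) (unfired-gain p (routeAt u c) u∉p)

  rotor-unfired : ∀ p c {v} → v ∉ p → rotor (run p c) v ≡ rotor c v
  rotor-unfired []      c v∉p = refl
  rotor-unfired (u ∷ p) c v∉p =
    trans (rotor-unfired p (routeAt u c) (v∉p ∘ there)) (rotor-unrouted c (v∉p ∘ here))

  count : Vertex → List Vertex → ℕ
  count t []      = 0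
  count t (v ∷ p) with t Fin.≟ v
  ... | yes _ = suc (count t p)
  ... | no _  = count t p

  count-here : ∀ t p → count t (t ∷ p) ≡ suc (count t p)
  count-here t p with t Fin.≟ t
  ... | yes _   = refl
  ... | no t≢t = ⊥-elim (t≢t refl)

  count-there : ∀ {t v} p → t ≢ v → count t (v ∷ p) ≡ count t p
  count-there {t} {v} p t≢v with t Fin.≟ v
  ... | yes t≡v = ⊥-elim (t≢v t≡v)
  ... | no _    = refl

  count-pos : ∀ {t p} → t ∈ p → ∃ λ k → count t p ≡ suc k
  count-pos {t} {v ∷ p} t∈ = cases (t Fin.≟ v) t∈
    where
      cases : Dec (t ≡ v) → t ∈ v ∷ p → ∃ λ k → count t (v ∷ p) ≡ suc k
      cases (yes refl) _           = count t p , count-here t p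
      cases (no t≢v)   (here t≡v)  = ⊥-elim (t≢v t≡v)
      cases (no t≢v)   (there t∈p) = let k , e = count-pos t∈p in k , trans (count-there p t≢v) e

  rotor-run : ∀ p c t → rotor (run p c) t ≡ iterate (count t p) (rotor c t)
  rotor-run []      c t = refl
  rotor-run (v ∷ p) c t = step (t Fin.≟ v)
    where
      step : Dec (t ≡ v) → rotor (run p (routeAt v c)) t ≡ iterate (count t (v ∷ p)) (rotor c t)
      step (yes refl) = trans (rotor-run p (routeAt t c) t)
        (trans (cong (iterate (count t p)) (rotor-routed c t))
               (cong (λ k → iterate k (rotor c t)) (sym (count-here t p))))
      step (no t≢v) = trans (rotor-run p (routeAt v c) t)
        (trans (cong (iterate (count t p)) (rotor-unrouted c t≢v))
               (cong (λ k → iterate k (rotor c t)) (sym (count-there p t≢v))))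

  sends-edge : ∀ p c t j → j ℕ.< count t p → Sends p c (head t (iterate (suc j) (rotor c t)))
  sends-edge (v ∷ p) c t j j< = step (t Fin.≟ v) j j<
    where
      step : Dec (t ≡ v) → ∀ j → j ℕ.< count t (v ∷ p) →
             Sends (v ∷ p) c (head t (iterate (suc j) (rotor c t)))
      step (yes refl) zero    _  = inj₁ refl
      step (yes refl) (suc j) j< = inj₂ (subst (λ r → Sends p (routeAt t c) (head t (iterate (suc j) r)))
        (rotor-routed c t)
        (sends-edge p (routeAt t c) t j (s≤s⁻¹ (subst (suc (suc j) ℕ.≤_) (count-here t p) j<))))
      step (no t≢v) j j< = inj₂ (subst (λ r → Sends p (routeAt v c) (head t (iterate (suc j) r)))
        (rotor-unrouted c t≢v)
        (sends-edge p (routeAt v c) t j (subst (suc j ℕ.≤_) (count-there p t≢v) j<)))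

  sends-last : ∀ p c {t} → t ∈ p → Sends p c (head t (rotor (run p c) t))
  sends-last p c {t} t∈p with count-pos t∈p
  ... | k , count≡ =
    subst (Sends p c ∘ head t) (sym final) (sends-edge p c t k (subst (k ℕ.<_) (sym count≡) ℕP.≤-refl))
    where
      final : rotor (run p c) t ≡ iterate (suc k) (rotor c t)
      final = trans (rotor-run p c t) (cong (λ j → iterate j (rotor c t)) count≡)

  chipsOn : (Vertex → Bool) → Config → ℤ
  chipsOn S c = sumᶠ (λ u → mask (S u) (chips c u))

  chipsOn-cong : ∀ S {c d} → c ≋ d → chipsOn S c ≡ chipsOn S d
  chipsOn-cong S (x≡ , _) = sum-cong (λ u → cong (mask (S u)) (x≡ u))

  chipsOn-route : ∀ S v c →
                  chipsOn S (routeAt v c) ≡ chipsOn S c - mask (S v) 1ℤ + mask (S (target c v)) 1ℤ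
  chipsOn-route S v c = begin
    sumᶠ (λ u → mask (S u) (chips c u - 𝟙 G v u + 𝟙 G (target c v) u))
      ≡⟨ sum-cong (λ u → mask-linear (S u) (chips c u) (𝟙 G v u) (𝟙 G (target c v) u)) ⟩
    sumᶠ (λ u → mask (S u) (chips c u) - mask (S u) (𝟙 G v u) + mask (S u) (𝟙 G (target c v) u))
      ≡⟨ sum-linear (λ u → mask (S u) (chips c u)) (λ u → mask (S u) (𝟙 G v u))
                    (λ u → mask (S u) (𝟙 G (target c v) u)) ⟩
    chipsOn S c - sumᶠ (λ u → mask (S u) (𝟙 G v u)) + sumᶠ (λ u → mask (S u) (𝟙 G (target c v) u))
      ≡⟨ cong₂ (λ a b → chipsOn S c - a + b) (indicator v) (indicator (target c v)) ⟩
    chipsOn S c - mask (S v) 1ℤ + mask (S (target c v)) 1ℤ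
      ∎
    where
      open ≡-Reasoning
      indicator : ∀ w → sumᶠ (λ u → mask (S u) (𝟙 G w u)) ≡ mask (S w) 1ℤ
      indicator w =
        trans (sum-single _ w (λ u u≢w → trans (cong (mask (S u)) (𝟙-other u≢w)) (mask-zero (S u))))
              (cong (mask (S w)) (𝟙-same w))

  chipsOn-route-leaves : ∀ S {v} c → S v ≡ true → S (target c v) ≡ false →
                         chipsOn S (routeAt v c) < chipsOn S c
  chipsOn-route-leaves S {v} c Sv St = <-by-one (trans (cong ℤ.suc (trans (chipsOn-route S v c)
    (cong₂ (λ a b → chipsOn S c - mask a 1ℤ + mask b 1ℤ) Sv St))) (lose-one (chipsOn S c)))
    where
      lose-one : ∀ x → 1ℤ + (x - 1ℤ + 0ℤ) ≡ x
      lose-one = solve-∀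

  chipsOn-route-inside : ∀ S {v} c → S v ≡ true → chipsOn S (routeAt v c) ≤ chipsOn S c
  chipsOn-route-inside S {v} c Sv with S (target c v) in St
  ... | false = ℤP.<⇒≤ (chipsOn-route-leaves S c Sv St)
  ... | true  = ℤP.≤-reflexive (trans (chipsOn-route S v c)
    (trans (cong₂ (λ a b → chipsOn S c - mask a 1ℤ + mask b 1ℤ) Sv St) (keep-one (chipsOn S c))))
    where
      keep-one : ∀ x → x - 1ℤ + 1ℤ ≡ x
      keep-one = solve-∀

  Inside : (Vertex → Bool) → List Vertex → Set
  Inside S p = ∀ t → t ∈ p → S t ≡ true

  chipsOn-run-inside : ∀ S p c → Inside S p → chipsOn S (run p c) ≤ chipsOn S c
  chipsOn-run-inside S []      c inside = ℤP.≤-refl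
  chipsOn-run-inside S (v ∷ p) c inside =
    ℤP.≤-trans (chipsOn-run-inside S p (routeAt v c) (λ t → inside t ∘ there))
               (chipsOn-route-inside S c (inside v (here refl)))

  chipsOn-run-leaves : ∀ S p c {h} → Inside S p → Sends p c h → S h ≡ false →
                       chipsOn S (run p c) < chipsOn S c
  chipsOn-run-leaves S (v ∷ p) c inside (inj₁ refl) Sh =
    ℤP.≤-<-trans (chipsOn-run-inside S p (routeAt v c) (λ t → inside t ∘ there))
                 (chipsOn-route-leaves S c (inside v (here refl)) Sh)
  chipsOn-run-leaves S (v ∷ p) c inside (inj₂ sent) Sh =
    ℤP.<-≤-trans (chipsOn-run-leaves S p (routeAt v c) (λ t → inside t ∘ there) sent Sh)
                 (chipsOn-route-inside S c (inside v (here refl)))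

  -- A word that restores c and routes some vertex routes every vertex: a routed vertex t makes
  -- full turns with its rotor, so it sends chips along all its edges, and a never-routed head of
  -- such an edge would end with more chips than it started with.  Strong connectivity concludes.
  cycle-routes-all : ∀ p c {v} → run p c ≋ c → v ∈ p → ∀ u → u ∈ p
  cycle-routes-all p c {v} returns v∈p u = along (strong v u) v∈p
    where
      edge-used : ∀ {t} → t ∈ p → ∀ e → Sends p c (head t e)
      edge-used {t} t∈p e with count-pos t∈p
      ... | k , count≡ with periodic-orbit (rotor c t) k period e
        where
          period : iterate (suc k) (rotor c t) ≡ rotor c t
          period = trans (cong (λ j → iterate j (rotor c t)) (sym count≡))
                         (trans (sym (rotor-run p c t)) (proj₂ returns t))
      ... | j , j≤k , reaches-e =
        subst (Sends p c ∘ head t) reaches-e (sends-edge p c t j (subst (j ℕ.<_) (sym count≡) (s≤s j≤k)))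
      successor-routed : ∀ {t} → t ∈ p → ∀ e → head t e ∈ p
      successor-routed {t} t∈p e with head t e ∈? p
      ... | yes h∈p = h∈p
      ... | no h∉p  =
        ⊥-elim (ℤP.<-irrefl (sym (proj₁ returns (head t e))) (unfired-strict p c h∉p (edge-used t∈p e)))
      along : ∀ {a b} → Star Edge a b → a ∈ p → b ∈ p
      along ε                 a∈p = a∈p
      along ((e , refl) ◅ path) a∈p = along path (successor-routed a∈p e)

  cycle-nonneg : ∀ p c → Legal p c → run p c ≋ c → (∀ u → u ∈ p) → ∀ u → 0ℤ ≤ chips c u
  cycle-nonneg p c legal returns all u = subst (0ℤ ≤_) (proj₁ returns u) (fired-nonneg p c legal (all u))

  split-last : ∀ (S : Vertex → Bool) p → Any (λ t → S t ≡ true) p →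
               ∃ λ a → ∃ λ v → ∃ λ b → p ≡ a ++ v ∷ b × S v ≡ true × (∀ t → t ∈ b → S t ≡ false)
  split-last S (v ∷ p) hit with any? (λ t → S t ≟ true) p
  ... | yes later =
    let a , u , b , p≡ , Su , after = split-last S p later in v ∷ a , u , b , cong (v ∷_) p≡ , Su , after
  ... | no none = [] , v , p , refl , first hit , λ t t∈p → BoolP.¬-not (none ∘ lose t∈p)
    where
      first : Any (λ t → S t ≡ true) (v ∷ p) → S v ≡ true
      first (here Sv)     = Sv
      first (there later) = ⊥-elim (none later)

  RotorEscapes : (Vertex → Bool) → Config → Vertex → Set
  RotorEscapes S c v = S (head v (rotor c v)) ≡ false ⊎ 1ℤ ≤ chips c (head v (rotor c v))

  -- In a legal cycle routing every vertex, consider the last routing at a vertex v of S.  The chip it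
  -- sends goes outside S, or to a vertex w of S that was routed before (so it was nonnegative) and is not
  -- routed again; in the final configuration the rotor of v points to w.
  last-routed : ∀ S p c {s} → Legal p c → run p c ≋ c → (∀ u → u ∈ p) → S s ≡ true →
                ∃ λ v → S v ≡ true × RotorEscapes S c v
  last-routed S p c {s} legal returns all Ss with split-last S p (lose (all s) Ss)
  ... | a , v , b , refl , Sv , after = v , Sv , subst Outcome (sym final-rotor) outcome
    where
      d : Config
      d = run a c
      w : Vertex
      w = target d v
      ends : run b (routeAt v d) ≋ c
      ends = subst (_≋ c) (run-++ a (v ∷ b) c) returns
      v∉b : v ∉ b
      v∉b v∈b = true≢false (trans (sym Sv) (after v v∈b))
      final-rotor : head v (rotor c v) ≡ w
      final-rotor = cong (head v)
        (trans (sym (proj₂ ends v)) (trans (rotor-unfired b (routeAt v d) v∉b) (rotor-routed d v)))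
      Outcome : Vertex → Set
      Outcome x = S x ≡ false ⊎ 1ℤ ≤ chips c x
      outcome : Outcome w
      outcome with S w in Sw
      ... | false = inj₁ refl
      ... | true  = inj₂ (ℤP.≤-trans (ℤP.≤-trans one (unfired-gain b (routeAt v d) w∉b))
                                      (ℤP.≤-reflexive (proj₁ ends w)))
        where
          w∉b : w ∉ b
          w∉b w∈b = true≢false (trans (sym Sw) (after w w∈b))
          routed-before : w ∈ a
          routed-before with ∈-++⁻ a (all w)
          ... | inj₁ w∈a          = w∈a
          ... | inj₂ (here w≡v)   = ⊥-elim (target≢ d v w≡v)
          ... | inj₂ (there w∈b)  = ⊥-elim (w∉b w∈b)
          one : 1ℤ ≤ chips (routeAt v d) w
          one = subst (1ℤ ≤_) (sym (chips-target d v))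
                  (ℤP.suc-mono (fired-nonneg a c (Legal-prefix a (v ∷ b) c legal) routed-before))

  inWord : List Vertex → Vertex → Bool
  inWord R u = does (u ∈? R)

  inWord-complete : ∀ {R u} → u ∈ R → inWord R u ≡ true
  inWord-complete {R} {u} = dec-true (u ∈? R)

  inWord-sound : ∀ {R u} → inWord R u ≡ true → u ∈ R
  inWord-sound {R} {u} S≡ with u ∈? R
  inWord-sound {R} {u} S≡ | yes u∈R = u∈R
  inWord-sound {R} {u} () | no _

  confined : ∀ S p c → Inside S p → (∀ u → S u ≡ true → chips c u ≤ 0ℤ) →
             (∀ u → S u ≡ true → 0ℤ ≤ chips (run p c) u) →
             (∀ h → Sends p c h → S h ≡ true) × (∀ u → S u ≡ true → chips (run p c) u ≤ 0ℤ)
  confined S p c inside start-nonpos end-nonneg = no-leak , empty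
    where
      masked-start : ∀ u → mask (S u) (chips c u) ≤ 0ℤ
      masked-start u with S u in Su
      ... | true  = start-nonpos u Su
      ... | false = ℤP.≤-refl
      masked-end : ∀ u → 0ℤ ≤ mask (S u) (chips (run p c) u)
      masked-end u with S u in Su
      ... | true  = end-nonneg u Su
      ... | false = ℤP.≤-refl
      start : chipsOn S c ≤ 0ℤ
      start = sum-nonpos _ masked-start
      end : 0ℤ ≤ chipsOn S (run p c)
      end = sum-nonneg _ masked-end
      no-leak : ∀ h → Sends p c h → S h ≡ true
      no-leak h sent with S h in Sh
      ... | true  = refl
      ... | false = ⊥-elim (ℤP.<-irrefl refl
                      (ℤP.<-≤-trans (chipsOn-run-leaves S p c inside sent Sh) (ℤP.≤-trans start end)))
      empty : ∀ u → S u ≡ true → chips (run p c) u ≤ 0ℤ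
      empty u Su = ℤP.≤-trans (subst (λ b → mask b (chips (run p c) u) ≤ chipsOn S (run p c)) Su
                                     (term≤sum _ masked-end u))
                              (ℤP.≤-trans (chipsOn-run-inside S p c inside) start)

  -- By confined (c₂ is nonnegative), the final rotors
  -- at the letters of R point to letters of R, and these hold no chips in c₂; last-routed says otherwise.
  stuck : ∀ {c₂} → LegalCycle c₂ → ∀ R c {r} → r ∈ R → (∀ t → t ∈ R → chips c t ≤ 0ℤ) → run R c ≋ c₂ → ⊥
  stuck {c₂} (v₀ , p₀ , legal , returns) R c {r} r∈R nonpos reaches =
    conclude (last-routed S (v₀ ∷ p₀) c₂ legal returns all (inWord-complete r∈R))
    where
      S : Vertex → Bool
      S = inWord R
      all : ∀ u → u ∈ v₀ ∷ p₀
      all = cycle-routes-all (v₀ ∷ p₀) c₂ returns (here refl)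
      R-confined : (∀ h → Sends R c h → S h ≡ true) × (∀ u → S u ≡ true → chips (run R c) u ≤ 0ℤ)
      R-confined = confined S R c (λ _ → inWord-complete) (λ u Su → nonpos u (inWord-sound Su))
        (λ u _ → subst (0ℤ ≤_) (sym (proj₁ reaches u)) (cycle-nonneg (v₀ ∷ p₀) c₂ legal returns all u))
      rotor-inside : ∀ {t} → S t ≡ true → S (head t (rotor c₂ t)) ≡ true
      rotor-inside {t} St =
        proj₁ R-confined _ (subst (Sends R c ∘ head t) (proj₂ reaches t) (sends-last R c (inWord-sound St)))
      empty : ∀ {w} → S w ≡ true → chips c₂ w ≤ 0ℤ
      empty {w} Sw = subst (_≤ 0ℤ) (proj₁ reaches w) (proj₂ R-confined w Sw)
      conclude : (∃ λ v → S v ≡ true × RotorEscapes S c₂ v) → ⊥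
      conclude (v , Sv , inj₁ outside) = true≢false (trans (sym (rotor-inside Sv)) outside)
      conclude (v , Sv , inj₂ chip)    with ℤP.≤-trans chip (empty (rotor-inside Sv))
      ... | ℤ.+≤+ ()

  -- Greedy routing: as long as some letter of the remaining word R holds a chip, route it
  -- (legally) first.  When R is used up, the legal cycle at c₂ closes the game; otherwise every
  -- remaining letter holds no chips, which is impossible by stuck.  k is the length of R.
  greedy : ∀ {c₂} → LegalCycle c₂ → ∀ k R c → length R ≡ k → run R c ≋ c₂ → LegalGame G c c₂
  greedy cycle k R c len reaches with any? (λ t → 0ℤ ℤ.<? chips c t) R
  greedy cycle k R c len reaches | yes positive with find positive
  greedy cycle zero R c len reaches | yes _ | t , t∈R , pos =
    ⊥-elim (ℕP.1+n≢0 (trans (length-remove t∈R) len))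
  greedy cycle (suc k) R c len reaches | yes _ | t , t∈R , pos = (t , pos , ≋-refl) ◅
    greedy cycle k (remove t∈R) (routeAt t c) (ℕP.suc-injective (trans (length-remove t∈R) len))
           (≋-trans (≋-sym (run-to-front c t∈R)) reaches)
  greedy (v₀ , p₀ , legal , returns) k [] c len reaches | no _ =
    legal-game v₀ p₀ (Legal-cong (v₀ ∷ p₀) (≋-sym reaches) legal)
                     (≋-trans (run-cong (v₀ ∷ p₀) reaches) returns)
  greedy cycle k (r ∷ R) c len reaches | no none =
    ⊥-elim (stuck cycle (r ∷ R) c (here refl) (λ t t∈R → ℤP.≮⇒≥ (none ∘ lose t∈R)) reaches)

proposition3p8 : (G : RibbonDigraph) (c₁ c₂ : DRC G) →
    Recurrent G c₂ → (LegalGame G c₁ c₂ ⇔ _∼_ G c₁ c₂)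
proposition3p8 G c₁ c₂ recurrent = mk⇔ forget-legality route-greedily
  where
    open Routing G
    forget-legality : LegalGame G c₁ c₂ → _∼_ G c₁ c₂
    forget-legality = Star.map (λ (v , _ , step) → v , step)
    route-greedily : _∼_ G c₁ c₂ → LegalGame G c₁ c₂
    route-greedily equivalent with unconstrained-word equivalent
    ... | R , reaches = greedy (legal-word recurrent) (length R) R c₁ refl reaches
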